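{- Let $l=(Fm_\Sigma(X),\vdash_l)$ be a logic whose cardinality $\kappa$ is regular, and $Y\supseteq X$. Let $E,C\colon\wp(Fm_\Sigma(Y))\to\wp(Fm_\Sigma(Y))$ be given by $E(\Gamma)=\{\varphi\mid\Gamma\vdash^{SS}\varphi\}$ and $C(\Gamma)=$ the smallest $l$-filter on $Fm_\Sigma(Y)$ containing $\Gamma$ (i.e. the closure operator of the logic $Log_Y$ of the canonical filter pair of $l$). Then $C$ is the idempotent hull of $E$, i.e. the smallest idempotent operator on $\wp(Fm_\Sigma(Y))$ with $E(\Gamma)\subseteq C(\Gamma)$ for all $\Gamma$ (equivalently, $C(\Gamma)$ is the smallest $Z\supseteq\Gamma$ with $E(Z)=Z$).
   Context: $Fm_\Sigma(Z)$ is the absolutely free $\Sigma$-algebra on $Z$. A logic $(Fm_\Sigma(X),\vdash_l)$ has $X$ infinite and $\vdash_l$ reflexive, monotone, cut-closed and structural; its cardinality is the least infinite $\lambda$ such that $\Gamma\vdash_l\varphi$ implies $\Gamma'\vdash_l\varphi$ for some $\Gamma'\subseteq\Gamma$ with $|\Gamma'|<\lambda$. The Shoesmith–Smiley relation on $Fm_\Sigma(Y)$: $\Gamma\vdash^{SS}\varphi$ iff there are $\Gamma'\cup\{\varphi'\}\subseteq Fm_\Sigma(X)$ and a homomorphism $v\colon Fm_\Sigma(X)\to Fm_\Sigma(Y)$ with $v(\Gamma')\subseteq\Gamma$, $v(\varphi')=\varphi$ and $\Gamma'\vdash_l\varphi'$. An $l$-filter on a $\Sigma$-algebra $A$ is $F\subseteq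 A$ such that $\Gamma\vdash_l\varphi$ and a homomorphism $v\colon Fm_\Sigma(X)\to A$ with $v(\Gamma)\subseteq F$ imply $v(\varphi)\in F$. -}

module Defs where

open import Level using (Level)
open import Data.Nat using (ℕ)
open import Data.Fin using (Fin)
open import Data.Product using (Σ; Σ-syntax; _×_)
open import Relation.Binary.PropositionalEquality using (_≡_)
open import Relation.Nullary using (¬_)
open import Function.Bundles using (_↣_)

record Signature : Set₁ where
  field
    Op    : Set
    arity : Op → ℕ

open Signature public

data Fm (Sg : Signature) (V : Set) : Set where
  var : V → Fm Sg V
  op  : (o : Op Sg) → (Fin (arity Sg o) → Fm Sg V) → Fm Sg V

IsHom : {Sg : Signature} {V W : Set} → (Fm Sg V → Fm Sg W) → Set
IsHom {Sg} h = ∀ (o : Op Sg) (ts : Fin (arity Sg o) → Fm Sg _) →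
  h (op o ts) ≡ op o (λ i → h (ts i))

_⊆_ : {ℓ : Level} {A : Set} → (A → Set ℓ) → (A → Set ℓ) → Set ℓ
P ⊆ Q = ∀ a → P a → Q a

_≐_ : {ℓ : Level} {A : Set} → (A → Set ℓ) → (A → Set ℓ) → Set ℓ
P ≐ Q = (P ⊆ Q) × (Q ⊆ P)

image : {A B : Set} → (A → B) → (A → Set) → B → Set
image f P b = Σ[ a ∈ _ ] (P a × f a ≡ b)

record Logic (Sg : Signature) (X : Set) : Set₁ where
  field
    _⊢_        : (Fm Sg X → Set) → Fm Sg X → Set
    infiniteX  : ℕ ↣ X
    reflexive  : ∀ Γ φ → Γ φ → Γ ⊢ φ
    monotone   : ∀ Γ Δ φ → Γ ⊆ Δ → Γ ⊢ φ → Δ ⊢ φ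
    cut        : ∀ Γ Δ φ → (∀ ψ → Δ ψ → Γ ⊢ ψ) → Δ ⊢ φ → Γ ⊢ φ
    structural : ∀ Γ φ (σ : Fm Sg X → Fm Sg X) → IsHom σ →
                 Γ ⊢ φ → image σ Γ ⊢ σ φ

open Logic public

_≼_ : Set → Set → Set
A ≼ B = A ↣ B

_≺_ : Set → Set → Set
A ≺ B = (A ≼ B) × ¬ (B ≼ A)

Infinite : Set → Set
Infinite A = ℕ ≼ A

CompactBelow : {Sg : Signature} {X : Set} → Logic Sg X → Set → Set₁
CompactBelow {Sg} {X} l λ′ =
  ∀ (Γ : Fm Sg X → Set) (φ : Fm Sg X) → _⊢_ l Γ φ →
    Σ[ Γ' ∈ (Fm Sg X → Set) ]
      (Γ' ⊆ Γ) × (Σ (Fm Sg X) Γ' ≺ λ′) × _⊢_ l Γ' φ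

HasCardinality : {Sg : Signature} {X : Set} → Logic Sg X → Set → Set₁
HasCardinality l κ =
  Infinite κ × CompactBelow l κ ×
  (∀ (λ′ : Set) → Infinite λ′ → CompactBelow l λ′ → κ ≼ λ′)

Regular : Set → Set₁
Regular κ =
  Infinite κ ×
  (∀ (I : Set) (A : I → Set) → I ≺ κ → (∀ i → A i ≺ κ) → Σ I A ≺ κ)

℘Fm : Signature → Set → Set₂
℘Fm Sg Y = Fm Sg Y → Set₁

SS : {Sg : Signature} {X Y : Set} → Logic Sg X → ℘Fm Sg Y → ℘Fm Sg Y
SS {Sg} {X} {Y} l Γ φ =
  Σ[ Γ' ∈ (Fm Sg X → Set) ] Σ[ φ' ∈ Fm Sg X ] Σ[ v ∈ (Fm Sg X → Fm Sg Y) ]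
    IsHom v × (∀ ψ → Γ' ψ → Γ (v ψ)) × (v φ' ≡ φ) × _⊢_ l Γ' φ'

IsFilter : {Sg : Signature} {X Y : Set} → Logic Sg X → ℘Fm Sg Y → Set₁
IsFilter {Sg} {X} {Y} l F =
  ∀ (Γ : Fm Sg X → Set) (φ : Fm Sg X) (v : Fm Sg X → Fm Sg Y) → IsHom v →
    _⊢_ l Γ φ → (∀ ψ → Γ ψ → F (v ψ)) → F (v φ)

IsFilterClosure : {Sg : Signature} {X Y : Set} → Logic Sg X →
                  (℘Fm Sg Y → ℘Fm Sg Y) → Set₂
IsFilterClosure {Sg} {X} {Y} l C =
  ∀ (Γ : ℘Fm Sg Y) →
    IsFilter l (C Γ) × (Γ ⊆ C Γ) ×
    (∀ (F : ℘Fm Sg Y) → IsFilter l F → Γ ⊆ F → C Γ ⊆ F)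

Idempotent : {Sg : Signature} {Y : Set} → (℘Fm Sg Y → ℘Fm Sg Y) → Set₂
Idempotent D = ∀ Γ → D (D Γ) ≐ D Γ

IsIdempotentHull : {Sg : Signature} {Y : Set} →
                   (℘Fm Sg Y → ℘Fm Sg Y) → (℘Fm Sg Y → ℘Fm Sg Y) → Set₂
IsIdempotentHull {Sg} {Y} E D =
  Idempotent D × (∀ Γ → E Γ ⊆ D Γ) ×
  (∀ (D' : ℘Fm Sg Y → ℘Fm Sg Y) → Idempotent D' → (∀ Γ → E Γ ⊆ D' Γ) →
     ∀ Γ → D Γ ⊆ D' Γ)

IsLeastFixpointAbove : {Sg : Signature} {Y : Set} →
                       (℘Fm Sg Y → ℘Fm Sg Y) → ℘Fm Sg Y → ℘Fm Sg Y → Set₂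
IsLeastFixpointAbove {Sg} {Y} E Γ Z =
  (Γ ⊆ Z) × (E Z ≐ Z) × (∀ (Z' : ℘Fm Sg Y) → Γ ⊆ Z' → E Z' ≐ Z' → Z ⊆ Z')

-- A subset of Fm_Σ(Y) is an l-filter exactly when it is closed under the
-- Shoesmith–Smiley relation, so C Γ is the least E-closed set containing Γ.
-- Since E is extensive and monotone, taking least E-closed supersets is the
-- idempotent hull of E: for idempotent D' ⊇ E, D' Γ is E-closed, as
-- E (D' Γ) ⊆ D' (D' Γ) = D' Γ.
module Submission where

open import Defs
open import Data.Product using (_×_; _,_)
open import Function.Bundles using (_↣_; Injection)
open import Relation.Binary.PropositionalEquality using (_≡_; refl)

substitute : {Sg : Signature} {X Y : Set} → (X → Fm Sg Y) → Fm Sg X → Fm Sg Y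
substitute s (var x)   = s x
substitute s (op o ts) = op o (λ i → substitute s (ts i))

substitute-isHom : {Sg : Signature} {X Y : Set} (s : X → Fm Sg Y) →
                   IsHom (substitute s)
substitute-isHom s o ts = refl

Closed : {Sg : Signature} {Y : Set} → (℘Fm Sg Y → ℘Fm Sg Y) → ℘Fm Sg Y → Set₁
Closed E F = E F ⊆ F

IsLeastClosedAbove : {Sg : Signature} {Y : Set} →
                     (℘Fm Sg Y → ℘Fm Sg Y) → ℘Fm Sg Y → ℘Fm Sg Y → Set₂
IsLeastClosedAbove {Sg} {Y} E Γ Z =
  (Γ ⊆ Z) × Closed E Z × (∀ (F : ℘Fm Sg Y) → Γ ⊆ F → Closed E F → Z ⊆ F)

module LeastClosed {Sg : Signature} {Y : Set} (E : ℘Fm Sg Y → ℘Fm Sg Y)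
    (E-extensive : ∀ Γ → Γ ⊆ E Γ)
    (E-monotone : ∀ Γ Δ → Γ ⊆ Δ → E Γ ⊆ E Δ)
    (C : ℘Fm Sg Y → ℘Fm Sg Y) (C-least : ∀ Γ → IsLeastClosedAbove E Γ (C Γ))
    where

  C-extensive : ∀ Γ → Γ ⊆ C Γ
  C-extensive Γ = let (extensive , _ , _) = C-least Γ in extensive

  C-closed : ∀ Γ → Closed E (C Γ)
  C-closed Γ = let (_ , closed , _) = C-least Γ in closed

  C-minimal : ∀ Γ F → Γ ⊆ F → Closed E F → C Γ ⊆ F
  C-minimal Γ = let (_ , _ , minimal) = C-least Γ in minimal

  C-idempotent : Idempotent C
  C-idempotent Γ =
    C-minimal (C Γ) (C Γ) (λ _ p → p) (C-closed Γ) , C-extensive (C Γ)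

  E⊆C : ∀ Γ → E Γ ⊆ C Γ
  E⊆C Γ φ p = C-closed Γ φ (E-monotone Γ (C Γ) (C-extensive Γ) φ p)

  idempotent⇒closed : ∀ (D : ℘Fm Sg Y → ℘Fm Sg Y) → Idempotent D →
                      (∀ Γ → E Γ ⊆ D Γ) → ∀ Γ → Closed E (D Γ)
  idempotent⇒closed D D-idempotent E⊆D Γ φ p =
    let (DD⊆D , _) = D-idempotent Γ in DD⊆D φ (E⊆D (D Γ) φ p)

  C-isIdempotentHull : IsIdempotentHull E C
  C-isIdempotentHull = C-idempotent , E⊆C , C-below-hulls
    where
    C-below-hulls : ∀ D → Idempotent D → (∀ Γ → E Γ ⊆ D Γ) → ∀ Γ → C Γ ⊆ D Γ
    C-below-hulls D D-idempotent E⊆D Γ =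
      C-minimal Γ (D Γ) (λ φ p → E⊆D Γ φ (E-extensive Γ φ p))
        (idempotent⇒closed D D-idempotent E⊆D Γ)

  C-isLeastFixpointAbove : ∀ Γ → IsLeastFixpointAbove E Γ (C Γ)
  C-isLeastFixpointAbove Γ =
    C-extensive Γ , (C-closed Γ , E-extensive (C Γ)) ,
    λ F Γ⊆F (EF⊆F , _) → C-minimal Γ F Γ⊆F EF⊆F

module _ {Sg : Signature} {X Y : Set} (l : Logic Sg X) where

  SS-extensive : ∀ Γ → Γ ⊆ SS {Y = Y} l Γ
  SS-extensive Γ φ φ∈Γ =
    (_≡ var x) , var x , substitute (λ _ → φ) , substitute-isHom (λ _ → φ) ,
    (λ { _ refl → φ∈Γ }) , refl , reflexive l _ (var x) refl
    where x = Injection.to (infiniteX l) 0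

  SS-monotone : ∀ Γ Δ → Γ ⊆ Δ → SS {Y = Y} l Γ ⊆ SS l Δ
  SS-monotone Γ Δ Γ⊆Δ φ (Γ' , φ' , v , v-hom , v[Γ']⊆Γ , vφ'≡φ , Γ'⊢φ') =
    Γ' , φ' , v , v-hom , (λ ψ p → Γ⊆Δ (v ψ) (v[Γ']⊆Γ ψ p)) , vφ'≡φ , Γ'⊢φ'

  filter⇒SS-closed : ∀ F → IsFilter l F → Closed (SS {Y = Y} l) F
  filter⇒SS-closed F F-filter _ (Γ' , φ' , v , v-hom , v[Γ']⊆F , refl , Γ'⊢φ') =
    F-filter Γ' φ' v v-hom Γ'⊢φ' v[Γ']⊆F

  SS-closed⇒filter : ∀ F → Closed (SS {Y = Y} l) F → IsFilter l F
  SS-closed⇒filter F F-closed Γ φ v v-hom Γ⊢φ v[Γ]⊆F =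
    F-closed (v φ) (Γ , φ , v , v-hom , v[Γ]⊆F , refl , Γ⊢φ)

  filterClosure⇒leastSSClosed : ∀ C → IsFilterClosure {Y = Y} l C →
                                 ∀ Γ → IsLeastClosedAbove (SS l) Γ (C Γ)
  filterClosure⇒leastSSClosed C C-filterClosure Γ =
    let (CΓ-filter , Γ⊆CΓ , CΓ-least) = C-filterClosure Γ in
    Γ⊆CΓ , filter⇒SS-closed (C Γ) CΓ-filter ,
    λ F Γ⊆F F-closed → CΓ-least F (SS-closed⇒filter F F-closed) Γ⊆F

proposition3p10 : (Sg : Signature) (X Y : Set) (l : Logic Sg X) (κ : Set) →
    HasCardinality l κ → Regular κ → X ↣ Y →
    (C : ℘Fm Sg Y → ℘Fm Sg Y) → IsFilterClosure {Y = Y} l C →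
    IsIdempotentHull (SS {Y = Y} l) C ×
    (∀ Γ → IsLeastFixpointAbove (SS {Y = Y} l) Γ (C Γ))
proposition3p10 Sg X Y l κ _ _ _ C C-filterClosure =
  C-isIdempotentHull , C-isLeastFixpointAbove
  where
  open LeastClosed (SS l) (SS-extensive l) (SS-monotone l) C
                   (filterClosure⇒leastSSClosed l C C-filterClosure)
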